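{- Let $e\in\mathcal{P}_n$ be an idempotent. Then there exist distinct positive integers $\beta_1,\dots,\beta_s$, positive integers $m_1,\dots,m_s$, and an integer $m\ge0$ such that (1) $m+\sum_{i=1}^s m_i\beta_i=n$, and (2) $\mathrm{Stab}_{\mathcal{S}_n}(e)\cong(\mathcal{S}_{m_1}\wr\mathcal{S}_{\beta_1-1})\times(\mathcal{S}_{m_2}\wr\mathcal{S}_{\beta_2-1})\times\cdots\times(\mathcal{S}_{m_s}\wr\mathcal{S}_{\beta_s-1})\times\mathcal{S}_m$.
   Context: $\mathcal{P}_n$ is the set of partial transformations of $[n]=\{1,\dots,n\}$, i.e. maps $f\colon A\to[n]$ defined on a subset $A\subseteq[n]$, with composition $(fg)(i)=f(g(i))$ where defined; an idempotent satisfies $e^2=e$; $\mathrm{Stab}_{\mathcal{S}_n}(e)=\{\pi\in\mathcal{S}_n:\pi e\pi^{ -1}=e\}$. Notation: $\mathcal{S}_m\wr\mathcal{S}_b$ denotes the group $(\mathcal{S}_b)^m\rtimes\mathcal{S}_m$ in which $\mathcal{S}_m$ permutes the $m$ factors $\mathcal{S}_b$ (order $m!\,(b!)^m$); $\mathcal{S}_0$ is the trivial group. -}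

module Defs where

open import Level using (0ℓ)
open import Data.Nat using (ℕ; suc; _∸_; _*_; _+_)
open import Data.Fin using (Fin)
open import Data.Maybe using (Maybe; just; nothing; _>>=_)
import Data.Maybe as Maybe
open import Data.Maybe.Properties using (map-id; map-∘; map-cong)
open import Data.Product using (Σ; ∃; _×_; _,_; proj₁; proj₂)
open import Data.Unit using (⊤; tt)
open import Data.List using (List; []; _∷_; map)
open import Data.Nat.ListAction using (sum)
open import Data.Fin.Permutation
  using (Permutation′; _⟨$⟩ʳ_; _⟨$⟩ˡ_; inverseˡ; inverseʳ; _∘ₚ_; flip)
  renaming (id to idₚ)
open import Relation.Binary.PropositionalEquality
  using (_≡_; refl; sym; trans; cong)
open import Algebra.Bundles.Raw using (RawGroup)
open import Algebra.Morphism.Structures using (module GroupMorphisms)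

-- Partial transformations of [n] = Fin n: a map Fin n → Maybe (Fin n)
-- (nothing = undefined; the domain A is the set of i with e i ≢ nothing).

PT : ℕ → Set
PT n = Fin n → Maybe (Fin n)

_·_ : ∀ {n} → PT n → PT n → PT n
(f · g) i = g i >>= f

IsIdempotent : ∀ {n} → PT n → Set
IsIdempotent e = ∀ i → (e · e) i ≡ e i

_∘S_ : ∀ {n} → Permutation′ n → Permutation′ n → Permutation′ n
π ∘S σ = σ ∘ₚ π      -- apply σ first, then π

SymGroup : ℕ → RawGroup 0ℓ 0ℓ
SymGroup n = record
  { Carrier = Permutation′ n
  ; _≈_     = λ π σ → ∀ i → π ⟨$⟩ʳ i ≡ σ ⟨$⟩ʳ i
  ; _∙_     = _∘S_
  ; ε       = idₚ
  ; _⁻¹     = flip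
  }

conj : ∀ {n} → Permutation′ n → PT n → PT n
conj π e i = Maybe.map (π ⟨$⟩ʳ_) (e (π ⟨$⟩ˡ i))

Stabilizes : ∀ {n} → PT n → Permutation′ n → Set
Stabilizes e π = ∀ i → conj π e i ≡ e i

stab-id : ∀ {n} (e : PT n) → Stabilizes e idₚ
stab-id e i = map-id (e i)

stab-∘ : ∀ {n} (e : PT n) {π σ} → Stabilizes e π → Stabilizes e σ →
         Stabilizes e (π ∘S σ)
stab-∘ e {π} {σ} sπ sσ i =
  trans (map-∘ (e (σ ⟨$⟩ˡ (π ⟨$⟩ˡ i))))
        (trans (cong (Maybe.map (π ⟨$⟩ʳ_)) (sσ (π ⟨$⟩ˡ i))) (sπ i))

stab-inv : ∀ {n} (e : PT n) {π} → Stabilizes e π → Stabilizes e (flip π)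
stab-inv e {π} sπ i =
  trans (cong (Maybe.map (π ⟨$⟩ˡ_)) (sym step))
        (trans (sym (map-∘ {g = π ⟨$⟩ˡ_} {f = π ⟨$⟩ʳ_} (e i))) (trans (map-cong (λ x → inverseˡ π {x}) (e i)) (map-id (e i))))
  where
  step : Maybe.map (π ⟨$⟩ʳ_) (e i) ≡ e (π ⟨$⟩ʳ i)
  step = trans (cong (λ j → Maybe.map (π ⟨$⟩ʳ_) (e j)) (sym (inverseˡ π))) (sπ (π ⟨$⟩ʳ i))

StabGroup : ∀ {n} → PT n → RawGroup 0ℓ 0ℓ
StabGroup {n} e = record
  { Carrier = Σ (Permutation′ n) (Stabilizes e)
  ; _≈_     = λ x y → ∀ i → proj₁ x ⟨$⟩ʳ i ≡ proj₁ y ⟨$⟩ʳ i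
  ; _∙_     = λ x y → (proj₁ x ∘S proj₁ y) , stab-∘ e {proj₁ x} {proj₁ y} (proj₂ x) (proj₂ y)
  ; ε       = idₚ , stab-id e
  ; _⁻¹     = λ x → flip (proj₁ x) , stab-inv e {proj₁ x} (proj₂ x)
  }

-- Wreath product S_m ≀ S_b = (S_b)^m ⋊ S_m, S_m permuting the factors.
-- Elements (f , σ) with f : Fin m → S_b, σ ∈ S_m; it acts on Fin m × Fin b
-- by (f , σ)·(i , x) = (σ i , f (σ i) x), giving
--   (f , σ)(g , τ) = (j ↦ f j ∘ g (σ⁻¹ j) , σ τ),
--   (f , σ)⁻¹     = (k ↦ (f (σ k))⁻¹ , σ⁻¹),   identity (j ↦ id , id).

Wreath : ℕ → ℕ → RawGroup 0ℓ 0ℓ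
Wreath m b = record
  { Carrier = (Fin m → Permutation′ b) × Permutation′ m
  ; _≈_     = λ x y → (∀ j x' → proj₁ x j ⟨$⟩ʳ x' ≡ proj₁ y j ⟨$⟩ʳ x')
                      × (∀ i → proj₂ x ⟨$⟩ʳ i ≡ proj₂ y ⟨$⟩ʳ i)
  ; _∙_     = λ x y → (λ j → proj₁ x j ∘S proj₁ y (proj₂ x ⟨$⟩ˡ j))
                      , (proj₂ x ∘S proj₂ y)
  ; ε       = (λ _ → idₚ) , idₚ
  ; _⁻¹     = λ x → (λ k → flip (proj₁ x (proj₂ x ⟨$⟩ʳ k))) , flip (proj₂ x)
  }

TrivialGroup : RawGroup 0ℓ 0ℓ
TrivialGroup = record
  { Carrier = ⊤ ; _≈_ = λ _ _ → ⊤ ; _∙_ = λ _ _ → tt ; ε = tt ; _⁻¹ = λ _ → tt }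

_⊗_ : RawGroup 0ℓ 0ℓ → RawGroup 0ℓ 0ℓ → RawGroup 0ℓ 0ℓ
G ⊗ H = record
  { Carrier = G.Carrier × H.Carrier
  ; _≈_     = λ x y → G._≈_ (proj₁ x) (proj₁ y) × H._≈_ (proj₂ x) (proj₂ y)
  ; _∙_     = λ x y → G._∙_ (proj₁ x) (proj₁ y) , H._∙_ (proj₂ x) (proj₂ y)
  ; ε       = G.ε , H.ε
  ; _⁻¹     = λ x → G._⁻¹ (proj₁ x) , H._⁻¹ (proj₂ x)
  }
  where module G = RawGroup G
        module H = RawGroup H

-- Data (β_i , m_i), i = 1..s, as a list of pairs.

WreathProduct : List (ℕ × ℕ) → ℕ → RawGroup 0ℓ 0ℓ
WreathProduct []             m = SymGroup m
WreathProduct ((β , k) ∷ ps) m = Wreath k (β ∸ 1) ⊗ WreathProduct ps m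

weight : List (ℕ × ℕ) → ℕ
weight ps = sum (map (λ p → proj₂ p * proj₁ p) ps)

_≅_ : RawGroup 0ℓ 0ℓ → RawGroup 0ℓ 0ℓ → Set
G ≅ H = ∃ λ (φ : RawGroup.Carrier G → RawGroup.Carrier H) →
          GroupMorphisms.IsGroupIsomorphism G H φ

-- An idempotent partial map e of [n] splits [n] into the m points where e is undefined, its
-- fixed points Y, and the remaining points X, which idempotency forces e to send into Y.  Up to
-- relabelling, e is therefore the retraction of Y ⊎ X onto Y along some c : X → Y, made undefined
-- on m further points.  A permutation commuting with e preserves the three pieces, so
-- Stab(e) ≅ Aut(c) × S_m, where Aut(c) consists of the pairs (σ on Y, τ on X) with c ∘ τ = σ ∘ c.
-- Such a σ preserves fibre sizes, so Aut(c) is the product, over the fibre sizes v that occur, of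
-- the automorphism groups of c restricted to the k_v fixed points with v-element fibres.  That
-- restriction is the projection [k_v] × [v] → [k_v], whose automorphism group is S_{k_v} ≀ S_v.
-- With β = v + 1, each such fixed point accounts for β points of [n], whence m + Σ k_v β = n.

module Submission where

open import Level using (0ℓ)
open import Defs
open import Algebra.Bundles.Raw using (RawGroup)
open import Data.Nat using (ℕ; zero; suc; _+_; _*_; _≤_; _<_; s≤s; z≤n)
import Data.Nat as ℕ
open import Data.Nat.Induction using (<-wellFounded)
open import Data.Nat.Properties
  using (+-0-commutativeMonoid; +-commutativeSemigroup; +-assoc; +-comm; +-suc; +-identityʳ;
         *-zeroʳ; *-identityʳ; *-suc; ≤-trans; +-monoˡ-≤; suc-injective)
open import Algebra.Properties.CommutativeMonoid.Sum +-0-commutativeMonoid using (sum; sum-cong-≗; sum-permute)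
open import Algebra.Properties.CommutativeSemigroup +-commutativeSemigroup using (interchange)
open import Data.Fin using (Fin; zero; suc; _≟_)
open import Data.Fin.Properties using (+↔⊎; toℕ<n)
open import Data.List using (List; []; _∷_; map)
open import Data.List.Relation.Unary.All using (All; []; _∷_)
import Data.List.Relation.Unary.All as All
import Data.List.Relation.Unary.All.Properties as All
import Data.List.Relation.Unary.AllPairs as AllPairs
open import Data.List.Relation.Unary.Unique.Propositional using (Unique)
open import Data.Maybe using (Maybe; just; nothing; _>>=_)
import Data.Maybe as Maybe
open import Data.Maybe.Properties using (just-injective; map-id; map-∘; map-cong; map-injective; ≡-dec)
open import Data.Product using (Σ; ∃; _×_; _,_; proj₁; proj₂)
import Data.Product as Product
open import Data.Product.Relation.Binary.Pointwise.NonDependent using (×-isEquivalence)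
open import Data.Sum using (_⊎_; inj₁; inj₂; swap)
import Data.Sum as Sum
open import Data.Sum.Algebra using (⊎-comm; ⊎-assoc)
open import Data.Sum.Function.Propositional using (_⊎-↔_)
open import Data.Sum.Properties using (inj₁-injective; inj₂-injective)
import Data.Vec.Functional.Relation.Binary.Pointwise.Properties as Pointwise
open import Function using (_∘_; id; case_of_)
open import Function.Bundles using (Inverse; _↔_; mk↔ₛ′)
open import Function.Construct.Composition using (_↔-∘_)
open import Function.Construct.Identity using (↔-id)
open import Function.Construct.Symmetry using (↔-sym)
open import Induction.WellFounded using (Acc; acc)
open import Relation.Binary.Bundles using (Setoid)
import Relation.Binary.Construct.On as On
open import Relation.Binary.PropositionalEquality hiding ([_])
open import Relation.Binary.Structures using (IsEquivalence)
open import Relation.Nullary using (Dec; yes; no; ¬_; contradiction)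
open import Relation.Unary using (Pred; Decidable)

open Inverse using (to; from; strictlyInverseˡ; strictlyInverseʳ)

-- Isomorphisms of raw groups and subgroups

≈-IsEquivalence : RawGroup 0ℓ 0ℓ → Set
≈-IsEquivalence G = IsEquivalence (RawGroup._≈_ G)

module _ (G H : RawGroup 0ℓ 0ℓ) where
  private
    module G = RawGroup G
    module H = RawGroup H

  -- RawGroup has no laws, so an isomorphism also carries the two equivalence proofs that
  -- composing isomorphisms needs.
  record GroupIso : Set where
    field
      isEquivalence₁ : IsEquivalence G._≈_
      isEquivalence₂ : IsEquivalence H._≈_
      φ      : G.Carrier → H.Carrier
      φ⁻¹    : H.Carrier → G.Carrier
      φ-cong   : ∀ {x y} → x G.≈ y → φ x H.≈ φ y
      φ⁻¹-cong : ∀ {x y} → x H.≈ y → φ⁻¹ x G.≈ φ⁻¹ y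
      φ∘φ⁻¹  : ∀ y → φ (φ⁻¹ y) H.≈ y
      φ⁻¹∘φ  : ∀ x → φ⁻¹ (φ x) G.≈ x
      ∙-homo : ∀ x y → φ (x G.∙ y) H.≈ (φ x H.∙ φ y)
      ε-homo : φ G.ε H.≈ H.ε
      ⁻¹-homo : ∀ x → φ (x G.⁻¹) H.≈ (φ x H.⁻¹)

GroupIso⇒≅ : ∀ {G H} → GroupIso G H → G ≅ H
GroupIso⇒≅ I = φ , record
  { isGroupMonomorphism = record
    { isGroupHomomorphism = record
      { isMonoidHomomorphism = record
        { isMagmaHomomorphism = record
          { isRelHomomorphism = record { cong = φ-cong }
          ; homo = ∙-homo }
        ; ε-homo = ε-homo }
      ; ⁻¹-homo = ⁻¹-homo }
    ; injective = λ {x} {y} φx≈φy →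
        G.trans (G.sym (φ⁻¹∘φ x)) (G.trans (φ⁻¹-cong φx≈φy) (φ⁻¹∘φ y)) }
  ; surjective = λ y → φ⁻¹ y , λ z≈ → H.trans (φ-cong z≈) (φ∘φ⁻¹ y) }
  where
  open GroupIso I
  module G = IsEquivalence isEquivalence₁
  module H = IsEquivalence isEquivalence₂

GroupIso-refl : ∀ {G} → ≈-IsEquivalence G → GroupIso G G
GroupIso-refl ≈G = record
  { isEquivalence₁ = ≈G ; isEquivalence₂ = ≈G
  ; φ = id ; φ⁻¹ = id ; φ-cong = id ; φ⁻¹-cong = id
  ; φ∘φ⁻¹ = λ _ → G.refl ; φ⁻¹∘φ = λ _ → G.refl
  ; ∙-homo = λ _ _ → G.refl ; ε-homo = G.refl ; ⁻¹-homo = λ _ → G.refl }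
  where module G = IsEquivalence ≈G

infixr 5 _⨾_

_⨾_ : ∀ {G H K} → GroupIso G H → GroupIso H K → GroupIso G K
I ⨾ J = record
  { isEquivalence₁ = I.isEquivalence₁
  ; isEquivalence₂ = J.isEquivalence₂
  ; φ = J.φ ∘ I.φ
  ; φ⁻¹ = I.φ⁻¹ ∘ J.φ⁻¹
  ; φ-cong = J.φ-cong ∘ I.φ-cong
  ; φ⁻¹-cong = I.φ⁻¹-cong ∘ J.φ⁻¹-cong
  ; φ∘φ⁻¹ = λ z → K.trans (J.φ-cong (I.φ∘φ⁻¹ (J.φ⁻¹ z))) (J.φ∘φ⁻¹ z)
  ; φ⁻¹∘φ = λ x → G.trans (I.φ⁻¹-cong (J.φ⁻¹∘φ (I.φ x))) (I.φ⁻¹∘φ x)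
  ; ∙-homo = λ x y → K.trans (J.φ-cong (I.∙-homo x y)) (J.∙-homo (I.φ x) (I.φ y))
  ; ε-homo = K.trans (J.φ-cong I.ε-homo) J.ε-homo
  ; ⁻¹-homo = λ x → K.trans (J.φ-cong (I.⁻¹-homo x)) (J.⁻¹-homo (I.φ x)) }
  where
  module I = GroupIso I
  module J = GroupIso J
  module G = IsEquivalence I.isEquivalence₁
  module K = IsEquivalence J.isEquivalence₂

⊗-isEquivalence : ∀ {G H} → ≈-IsEquivalence G → ≈-IsEquivalence H → ≈-IsEquivalence (G ⊗ H)
⊗-isEquivalence = ×-isEquivalence

⊗-congIso : ∀ {G G′ H H′} → GroupIso G G′ → GroupIso H H′ → GroupIso (G ⊗ H) (G′ ⊗ H′)
⊗-congIso I J = record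
  { isEquivalence₁ = ×-isEquivalence I.isEquivalence₁ J.isEquivalence₁
  ; isEquivalence₂ = ×-isEquivalence I.isEquivalence₂ J.isEquivalence₂
  ; φ = λ (x , y) → I.φ x , J.φ y
  ; φ⁻¹ = λ (x , y) → I.φ⁻¹ x , J.φ⁻¹ y
  ; φ-cong = λ (p , q) → I.φ-cong p , J.φ-cong q
  ; φ⁻¹-cong = λ (p , q) → I.φ⁻¹-cong p , J.φ⁻¹-cong q
  ; φ∘φ⁻¹ = λ (x , y) → I.φ∘φ⁻¹ x , J.φ∘φ⁻¹ y
  ; φ⁻¹∘φ = λ (x , y) → I.φ⁻¹∘φ x , J.φ⁻¹∘φ y
  ; ∙-homo = λ (x , y) (x′ , y′) → I.∙-homo x x′ , J.∙-homo y y′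
  ; ε-homo = I.ε-homo , J.ε-homo
  ; ⁻¹-homo = λ (x , y) → I.⁻¹-homo x , J.⁻¹-homo y }
  where
  module I = GroupIso I
  module J = GroupIso J

⊗-assocIso : ∀ {G H K} → ≈-IsEquivalence G → ≈-IsEquivalence H → ≈-IsEquivalence K →
             GroupIso ((G ⊗ H) ⊗ K) (G ⊗ (H ⊗ K))
⊗-assocIso {G} {H} {K} ≈G ≈H ≈K = record
  { isEquivalence₁ = ×-isEquivalence (×-isEquivalence ≈G ≈H) ≈K
  ; isEquivalence₂ = ×-isEquivalence ≈G (×-isEquivalence ≈H ≈K)
  ; φ = λ ((a , b) , c) → a , (b , c)
  ; φ⁻¹ = λ (a , (b , c)) → (a , b) , c
  ; φ-cong = λ ((p , q) , r) → p , (q , r)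
  ; φ⁻¹-cong = λ (p , (q , r)) → (p , q) , r
  ; φ∘φ⁻¹ = λ _ → ≈-refl
  ; φ⁻¹∘φ = λ _ → (G.refl , H.refl) , K.refl
  ; ∙-homo = λ _ _ → ≈-refl
  ; ε-homo = ≈-refl
  ; ⁻¹-homo = λ _ → ≈-refl }
  where
  module G = IsEquivalence ≈G
  module H = IsEquivalence ≈H
  module K = IsEquivalence ≈K
  ≈-refl : ∀ {x} → RawGroup._≈_ (G ⊗ (H ⊗ K)) x x
  ≈-refl = G.refl , (H.refl , K.refl)

⊗-interchangeIso : ∀ {G₁ G₂ H₁ H₂} → ≈-IsEquivalence G₁ → ≈-IsEquivalence G₂ →
                   ≈-IsEquivalence H₁ → ≈-IsEquivalence H₂ →
                   GroupIso ((G₁ ⊗ G₂) ⊗ (H₁ ⊗ H₂)) ((G₁ ⊗ H₁) ⊗ (G₂ ⊗ H₂))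
⊗-interchangeIso {G₁} {G₂} {H₁} {H₂} ≈G₁ ≈G₂ ≈H₁ ≈H₂ = record
  { isEquivalence₁ = ×-isEquivalence (×-isEquivalence ≈G₁ ≈G₂) (×-isEquivalence ≈H₁ ≈H₂)
  ; isEquivalence₂ = ×-isEquivalence (×-isEquivalence ≈G₁ ≈H₁) (×-isEquivalence ≈G₂ ≈H₂)
  ; φ = λ ((g₁ , g₂) , (h₁ , h₂)) → (g₁ , h₁) , (g₂ , h₂)
  ; φ⁻¹ = λ ((g₁ , h₁) , (g₂ , h₂)) → (g₁ , g₂) , (h₁ , h₂)
  ; φ-cong = λ ((p₁ , p₂) , (q₁ , q₂)) → (p₁ , q₁) , (p₂ , q₂)
  ; φ⁻¹-cong = λ ((p₁ , q₁) , (p₂ , q₂)) → (p₁ , p₂) , (q₁ , q₂)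
  ; φ∘φ⁻¹ = λ _ → ≈-refl
  ; φ⁻¹∘φ = λ _ → (G₁.refl , G₂.refl) , (H₁.refl , H₂.refl)
  ; ∙-homo = λ _ _ → ≈-refl
  ; ε-homo = ≈-refl
  ; ⁻¹-homo = λ _ → ≈-refl }
  where
  module G₁ = IsEquivalence ≈G₁
  module G₂ = IsEquivalence ≈G₂
  module H₁ = IsEquivalence ≈H₁
  module H₂ = IsEquivalence ≈H₂
  ≈-refl : ∀ {x} → RawGroup._≈_ ((G₁ ⊗ H₁) ⊗ (G₂ ⊗ H₂)) x x
  ≈-refl = (G₁.refl , H₁.refl) , (G₂.refl , H₂.refl)

module _ (G : RawGroup 0ℓ 0ℓ) where
  open RawGroup G

  record IsSubgroup (P : Carrier → Set) : Set where
    field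
      ε-closed  : P ε
      ∙-closed  : ∀ {x y} → P x → P y → P (x ∙ y)
      ⁻¹-closed : ∀ {x} → P x → P (x ⁻¹)

  Subgroup : (P : Carrier → Set) → IsSubgroup P → RawGroup 0ℓ 0ℓ
  Subgroup P isSub = record
    { Carrier = Σ Carrier P
    ; _≈_ = λ x y → proj₁ x ≈ proj₁ y
    ; _∙_ = λ (x , p) (y , q) → x ∙ y , ∙-closed p q
    ; ε = ε , ε-closed
    ; _⁻¹ = λ (x , p) → x ⁻¹ , ⁻¹-closed p
    }
    where open IsSubgroup isSub

Subgroup-isEquivalence : ∀ {G P} (isSub : IsSubgroup G P) → ≈-IsEquivalence G →
                         ≈-IsEquivalence (Subgroup G P isSub)
Subgroup-isEquivalence isSub ≈G = On.isEquivalence proj₁ ≈G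

Subgroup-iso : ∀ {G H P Q} {isSubP : IsSubgroup G P} {isSubQ : IsSubgroup H Q} (I : GroupIso G H) →
               (∀ {x} → P x → Q (GroupIso.φ I x)) → (∀ {y} → Q y → P (GroupIso.φ⁻¹ I y)) →
               GroupIso (Subgroup G P isSubP) (Subgroup H Q isSubQ)
Subgroup-iso I φ-closed φ⁻¹-closed = record
  { isEquivalence₁ = On.isEquivalence proj₁ isEquivalence₁
  ; isEquivalence₂ = On.isEquivalence proj₁ isEquivalence₂
  ; φ = λ (x , p) → φ x , φ-closed p
  ; φ⁻¹ = λ (y , q) → φ⁻¹ y , φ⁻¹-closed q
  ; φ-cong = φ-cong
  ; φ⁻¹-cong = φ⁻¹-cong
  ; φ∘φ⁻¹ = φ∘φ⁻¹ ∘ proj₁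
  ; φ⁻¹∘φ = φ⁻¹∘φ ∘ proj₁
  ; ∙-homo = λ x y → ∙-homo (proj₁ x) (proj₁ y)
  ; ε-homo = ε-homo
  ; ⁻¹-homo = ⁻¹-homo ∘ proj₁ }
  where open GroupIso I

Subgroup-refine : ∀ {G H R P Q} {isSubR : IsSubgroup G R} {isSubP : IsSubgroup G P} {isSubQ : IsSubgroup H Q} →
                  (I : GroupIso (Subgroup G R isSubR) H) (P⇒R : ∀ {x} → P x → R x) →
                  (∀ {x} (p : P x) → Q (GroupIso.φ I (x , P⇒R p))) →
                  (∀ {y} → Q y → P (proj₁ (GroupIso.φ⁻¹ I y))) →
                  GroupIso (Subgroup G P isSubP) (Subgroup H Q isSubQ)
Subgroup-refine {H = H} {isSubR = isSubR} I P⇒R φ-closed φ⁻¹-closed = record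
  { isEquivalence₁ = On.isEquivalence (Product.map₂ P⇒R) isEquivalence₁
  ; isEquivalence₂ = On.isEquivalence proj₁ isEquivalence₂
  ; φ = λ (x , p) → φ (x , P⇒R p) , φ-closed p
  ; φ⁻¹ = λ (y , q) → proj₁ (φ⁻¹ y) , φ⁻¹-closed q
  ; φ-cong = φ-cong
  ; φ⁻¹-cong = φ⁻¹-cong
  ; φ∘φ⁻¹ = λ (y , q) → H.trans (φ-irrelevant _ (proj₂ (φ⁻¹ y))) (φ∘φ⁻¹ y)
  ; φ⁻¹∘φ = λ (x , p) → φ⁻¹∘φ (x , P⇒R p)
  ; ∙-homo = λ (x , p) (y , q) →
      H.trans (φ-irrelevant _ (R.∙-closed (P⇒R p) (P⇒R q))) (∙-homo (x , P⇒R p) (y , P⇒R q))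
  ; ε-homo = H.trans (φ-irrelevant _ R.ε-closed) ε-homo
  ; ⁻¹-homo = λ (x , p) → H.trans (φ-irrelevant _ (R.⁻¹-closed (P⇒R p))) (⁻¹-homo (x , P⇒R p)) }
  where
  open GroupIso I
  module R = IsSubgroup isSubR
  module H = IsEquivalence isEquivalence₂
  φ-irrelevant : ∀ {x} (r r′ : _) → RawGroup._≈_ H (φ (x , r)) (φ (x , r′))
  φ-irrelevant {x} r r′ = φ-cong {x , r} {x , r′} (IsEquivalence.refl isEquivalence₁ {x , r})

⊗-isSubgroup : ∀ {G H P Q} → IsSubgroup G P → IsSubgroup H Q → IsSubgroup (G ⊗ H) (λ (x , y) → P x × Q y)
⊗-isSubgroup isSubP isSubQ = record
  { ε-closed = P.ε-closed , Q.ε-closed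
  ; ∙-closed = λ (p , q) (p′ , q′) → P.∙-closed p p′ , Q.∙-closed q q′
  ; ⁻¹-closed = λ (p , q) → P.⁻¹-closed p , Q.⁻¹-closed q }
  where
  module P = IsSubgroup isSubP
  module Q = IsSubgroup isSubQ

Subgroup-⊗ : ∀ {G H P Q} (isSubP : IsSubgroup G P) (isSubQ : IsSubgroup H Q) →
             ≈-IsEquivalence G → ≈-IsEquivalence H →
             GroupIso (Subgroup (G ⊗ H) _ (⊗-isSubgroup isSubP isSubQ))
                      (Subgroup G P isSubP ⊗ Subgroup H Q isSubQ)
Subgroup-⊗ _ _ ≈G ≈H = record
  { isEquivalence₁ = On.isEquivalence proj₁ (×-isEquivalence ≈G ≈H)
  ; isEquivalence₂ = ×-isEquivalence (On.isEquivalence proj₁ ≈G) (On.isEquivalence proj₁ ≈H)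
  ; φ = λ ((x , y) , (p , q)) → (x , p) , (y , q)
  ; φ⁻¹ = λ ((x , p) , (y , q)) → (x , y) , (p , q)
  ; φ-cong = id
  ; φ⁻¹-cong = id
  ; φ∘φ⁻¹ = λ _ → G.refl , H.refl
  ; φ⁻¹∘φ = λ _ → G.refl , H.refl
  ; ∙-homo = λ _ _ → G.refl , H.refl
  ; ε-homo = G.refl , H.refl
  ; ⁻¹-homo = λ _ → G.refl , H.refl }
  where
  module G = IsEquivalence ≈G
  module H = IsEquivalence ≈H

Subgroup-⊗ˡ : ∀ {G H P} (isSubP : IsSubgroup G P) → ≈-IsEquivalence G → ≈-IsEquivalence H →
              GroupIso (Subgroup (G ⊗ H) (P ∘ proj₁) (record { IsSubgroup isSubP }))
                       (Subgroup G P isSubP ⊗ H)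
Subgroup-⊗ˡ _ ≈G ≈H = record
  { isEquivalence₁ = On.isEquivalence proj₁ (×-isEquivalence ≈G ≈H)
  ; isEquivalence₂ = ×-isEquivalence (On.isEquivalence proj₁ ≈G) ≈H
  ; φ = λ ((x , y) , p) → (x , p) , y
  ; φ⁻¹ = λ ((x , p) , y) → (x , y) , p
  ; φ-cong = id
  ; φ⁻¹-cong = id
  ; φ∘φ⁻¹ = λ _ → G.refl , H.refl
  ; φ⁻¹∘φ = λ _ → G.refl , H.refl
  ; ∙-homo = λ _ _ → G.refl , H.refl
  ; ε-homo = G.refl , H.refl
  ; ⁻¹-homo = λ _ → G.refl , H.refl }
  where
  module G = IsEquivalence ≈G
  module H = IsEquivalence ≈H

-- Symmetric groups and stabilisers of partial maps

≗-isEquivalence : {A B : Set} → IsEquivalence (_≗_ {A = A} {B = B})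
≗-isEquivalence {A} {B} = Setoid.isEquivalence (A →-setoid B)

Sym : Set → Set
Sym X = X ↔ X

Symmetric : Set → RawGroup 0ℓ 0ℓ
Symmetric X = record
  { Carrier = Sym X
  ; _≈_ = λ π σ → to π ≗ to σ
  ; _∙_ = _↔-∘_
  ; ε = ↔-id X
  ; _⁻¹ = ↔-sym
  }

Symmetric-isEquivalence : ∀ X → ≈-IsEquivalence (Symmetric X)
Symmetric-isEquivalence X = On.isEquivalence to ≗-isEquivalence

Wreath-isEquivalence : ∀ m b → ≈-IsEquivalence (Wreath m b)
Wreath-isEquivalence m b =
  ×-isEquivalence (Pointwise.isEquivalence (Symmetric-isEquivalence (Fin b)) m) (Symmetric-isEquivalence (Fin m))

from-≗ : ∀ {X Y : Set} (f g : X ↔ Y) → to f ≗ to g → from f ≗ from g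
from-≗ f g f≗g y = begin
  from f y               ≡⟨ cong (from f) (strictlyInverseˡ g y) ⟨
  from f (to g (from g y)) ≡⟨ cong (from f) (f≗g (from g y)) ⟨
  from f (to f (from g y)) ≡⟨ strictlyInverseʳ f (from g y) ⟩
  from g y               ∎
  where open ≡-Reasoning

from-injective : ∀ {A B : Set} (h : A ↔ B) {y y′} → from h y ≡ from h y′ → y ≡ y′
from-injective h {y} {y′} eq = trans (sym (strictlyInverseˡ h y)) (trans (cong (to h) eq) (strictlyInverseˡ h y′))

conjugate : ∀ {X X′} → X ↔ X′ → Sym X → Sym X′
conjugate h π = h ↔-∘ (π ↔-∘ ↔-sym h)

conjugationIso : ∀ {X X′} → X ↔ X′ → GroupIso (Symmetric X) (Symmetric X′)
conjugationIso h = record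
  { isEquivalence₁ = Symmetric-isEquivalence _
  ; isEquivalence₂ = Symmetric-isEquivalence _
  ; φ = conjugate h
  ; φ⁻¹ = conjugate (↔-sym h)
  ; φ-cong = λ π≗σ → cong (to h) ∘ π≗σ ∘ from h
  ; φ⁻¹-cong = λ π≗σ → cong (from h) ∘ π≗σ ∘ to h
  ; φ∘φ⁻¹ = λ π x → trans (strictlyInverseˡ h _) (cong (to π) (strictlyInverseˡ h x))
  ; φ⁻¹∘φ = λ π x → trans (strictlyInverseʳ h _) (cong (to π) (strictlyInverseʳ h x))
  ; ∙-homo = λ π σ x → cong (to h ∘ to π) (sym (strictlyInverseʳ h _))
  ; ε-homo = strictlyInverseˡ h
  ; ⁻¹-homo = λ _ _ → refl }

record Conjugates {X X′} (h : X ↔ X′) (e : X → Maybe X) (e′ : X′ → Maybe X′) : Set where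
  constructor commuting
  field commutes : ∀ x → e′ (to h x) ≡ Maybe.map (to h) (e x)
open Conjugates

Conjugates-id : ∀ {X} (e : X → Maybe X) → Conjugates (↔-id X) e e
Conjugates-id e = commuting λ x → sym (map-id (e x))

Conjugates-∘ : ∀ {X X′ X″} {g : X′ ↔ X″} {h : X ↔ X′} {e e′ e″} →
               Conjugates g e′ e″ → Conjugates h e e′ → Conjugates (g ↔-∘ h) e e″
Conjugates-∘ {g = g} {h} {e} g-conj h-conj = commuting λ x →
  trans (commutes g-conj (to h x)) (trans (cong (Maybe.map (to g)) (commutes h-conj x)) (sym (map-∘ (e x))))

Conjugates-sym : ∀ {X X′} {h : X ↔ X′} {e e′} → Conjugates h e e′ → Conjugates (↔-sym h) e′ e
Conjugates-sym {h = h} {e} {e′} h-conj = commuting λ x′ → let x = from h x′ in begin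
  e x                                         ≡⟨ trans (map-cong (strictlyInverseʳ h) (e x)) (map-id (e x)) ⟨
  Maybe.map (from h ∘ to h) (e x)             ≡⟨ map-∘ (e x) ⟩
  Maybe.map (from h) (Maybe.map (to h) (e x)) ≡⟨ cong (Maybe.map (from h)) (commutes h-conj x) ⟨
  Maybe.map (from h) (e′ (to h x))            ≡⟨ cong (Maybe.map (from h) ∘ e′) (strictlyInverseˡ h x′) ⟩
  Maybe.map (from h) (e′ x′)                  ∎
  where open ≡-Reasoning

Stable : ∀ {X} → (X → Maybe X) → Sym X → Set
Stable e π = Conjugates π e e

Stable-just : ∀ {X} {e : X → Maybe X} {π x w} → Stable e π → e x ≡ just w → e (to π x) ≡ just (to π w)
Stable-just {π = π} π-stable ex≡w = trans (commutes π-stable _) (cong (Maybe.map (to π)) ex≡w)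

Stable-isSubgroup : ∀ {X} (e : X → Maybe X) → IsSubgroup (Symmetric X) (Stable e)
Stable-isSubgroup e = record
  { ε-closed = Conjugates-id e
  ; ∙-closed = Conjugates-∘
  ; ⁻¹-closed = Conjugates-sym }

Stab : ∀ {X} → (X → Maybe X) → RawGroup 0ℓ 0ℓ
Stab e = Subgroup (Symmetric _) (Stable e) (Stable-isSubgroup e)

Stab-transport : ∀ {X X′} {h : X ↔ X′} {e e′} → Conjugates h e e′ → GroupIso (Stab e) (Stab e′)
Stab-transport {h = h} h-conj = Subgroup-iso (conjugationIso h)
  (λ {π} π-stable → Conjugates-∘ {g = h ↔-∘ π} (Conjugates-∘ {g = h} h-conj π-stable)
                                               (Conjugates-sym h-conj))
  (λ {π} π-stable → Conjugates-∘ {g = ↔-sym h ↔-∘ π} (Conjugates-∘ {g = ↔-sym h} (Conjugates-sym h-conj) π-stable)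
                                                     h-conj)

Stabilizes⇒Stable : ∀ {n} {e : PT n} {π} → Stabilizes e π → Stable e π
Stabilizes⇒Stable {e = e} {π} π-stab = commuting λ x →
  trans (sym (π-stab (to π x))) (cong (Maybe.map (to π) ∘ e) (strictlyInverseʳ π x))

Stable⇒Stabilizes : ∀ {n} {e : PT n} {π} → Stable e π → Stabilizes e π
Stable⇒Stabilizes {e = e} {π} π-stable i =
  trans (sym (commutes π-stable (from π i))) (cong e (strictlyInverseˡ π i))

StabGroup≅Stab : ∀ {n} (e : PT n) → GroupIso (StabGroup e) (Stab e)
StabGroup≅Stab e = Subgroup-iso (GroupIso-refl (Symmetric-isEquivalence _)) Stabilizes⇒Stable Stable⇒Stabilizes

-- Automorphisms of coloured maps

-- The colouring of the codomain travels with the map: it records fibre sizes computed on Fin,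
-- which must survive transport along bijections to sums of other types.
record IsColouredIso {C X X′ Y Y′ : Set} (hY : Y ↔ Y′) (hX : X ↔ X′)
                     (c : X → Y) (col : Y → C) (c′ : X′ → Y′) (col′ : Y′ → C) : Set where
  constructor colouredIso
  field
    intertwines  : ∀ x → c′ (to hX x) ≡ to hY (c x)
    keeps-colour : ∀ y → col′ (to hY y) ≡ col y
open IsColouredIso

module _ {C : Set} where
  IsColouredIso-id : ∀ {X Y} (c : X → Y) (col : Y → C) → IsColouredIso (↔-id Y) (↔-id X) c col c col
  IsColouredIso-id c col = colouredIso (λ _ → refl) (λ _ → refl)

  IsColouredIso-∘ : ∀ {X X′ X″ Y Y′ Y″} {gY : Y′ ↔ Y″} {gX : X′ ↔ X″} {hY : Y ↔ Y′} {hX : X ↔ X′}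
                      {c : X → Y} {col : Y → C} {c′ col′ c″ col″} →
                    IsColouredIso gY gX c′ col′ c″ col″ → IsColouredIso hY hX c col c′ col′ →
                    IsColouredIso (gY ↔-∘ hY) (gX ↔-∘ hX) c col c″ col″
  IsColouredIso-∘ {gY = gY} {hX = hX} g h = colouredIso
    (λ x → trans (intertwines g (to hX x)) (cong (to gY) (intertwines h x)))
    (λ y → trans (keeps-colour g _) (keeps-colour h y))

  IsColouredIso-sym : ∀ {X X′ Y Y′} {hY : Y ↔ Y′} {hX : X ↔ X′} {c : X → Y} {col : Y → C} {c′ col′} →
                      IsColouredIso hY hX c col c′ col′ → IsColouredIso (↔-sym hY) (↔-sym hX) c′ col′ c col
  IsColouredIso-sym {hY = hY} {hX} {c} {col} {c′} {col′} h = colouredIso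
    (λ x′ → begin
      c (from hX x′)                     ≡⟨ strictlyInverseʳ hY _ ⟨
      from hY (to hY (c (from hX x′)))   ≡⟨ cong (from hY) (intertwines h (from hX x′)) ⟨
      from hY (c′ (to hX (from hX x′)))  ≡⟨ cong (from hY ∘ c′) (strictlyInverseˡ hX x′) ⟩
      from hY (c′ x′)                    ∎)
    (λ y′ → trans (sym (keeps-colour h (from hY y′))) (cong col′ (strictlyInverseˡ hY y′)))
    where open ≡-Reasoning

  IsColouredAut : ∀ {X Y} → (X → Y) → (Y → C) → Sym Y × Sym X → Set
  IsColouredAut c col (σ , τ) = IsColouredIso σ τ c col c col

  Aut-isSubgroup : ∀ {X Y} (c : X → Y) (col : Y → C) →
                   IsSubgroup (Symmetric Y ⊗ Symmetric X) (IsColouredAut c col)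
  Aut-isSubgroup c col = record
    { ε-closed = IsColouredIso-id c col
    ; ∙-closed = IsColouredIso-∘
    ; ⁻¹-closed = IsColouredIso-sym }

  Aut : ∀ {X Y} → (X → Y) → (Y → C) → RawGroup 0ℓ 0ℓ
  Aut c col = Subgroup (Symmetric _ ⊗ Symmetric _) (IsColouredAut c col) (Aut-isSubgroup c col)

  Aut-isEquivalence : ∀ {X Y} (c : X → Y) (col : Y → C) → ≈-IsEquivalence (Aut c col)
  Aut-isEquivalence {X} {Y} c col = Subgroup-isEquivalence (Aut-isSubgroup c col)
    (⊗-isEquivalence {Symmetric Y} {Symmetric X} (Symmetric-isEquivalence Y) (Symmetric-isEquivalence X))

  Aut-transport : ∀ {X X′ Y Y′} {hY : Y ↔ Y′} {hX : X ↔ X′} {c : X → Y} {col : Y → C} {c′ col′} →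
                  IsColouredIso hY hX c col c′ col′ → GroupIso (Aut c col) (Aut c′ col′)
  Aut-transport {hY = hY} {hX} h = Subgroup-iso (⊗-congIso (conjugationIso hY) (conjugationIso hX))
    (λ {(σ , τ)} aut → IsColouredIso-∘ {gY = hY ↔-∘ σ} {hX ↔-∘ τ}
       (IsColouredIso-∘ {gY = hY} {hX} h aut) (IsColouredIso-sym h))
    (λ {(σ , τ)} aut → IsColouredIso-∘ {gY = ↔-sym hY ↔-∘ σ} {↔-sym hX ↔-∘ τ}
       (IsColouredIso-∘ {gY = ↔-sym hY} {↔-sym hX} (IsColouredIso-sym h) aut) h)

module _ {C X Y : Set} {c : X → Y} {col : Y → C} where
  IsColouredAut-resp : ∀ {σ σ′ : Sym Y} {τ τ′ : Sym X} → to σ ≗ to σ′ → to τ ≗ to τ′ →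
                       IsColouredAut c col (σ , τ) → IsColouredAut c col (σ′ , τ′)
  IsColouredAut-resp σ≗σ′ τ≗τ′ aut = colouredIso
    (λ x → trans (cong c (sym (τ≗τ′ x))) (trans (intertwines aut x) (σ≗σ′ _)))
    (λ y → trans (cong col (sym (σ≗σ′ y))) (keeps-colour aut y))

module _ {C X₁ X₂ Y₁ Y₂ : Set} {c₁ : X₁ → Y₁} {c₂ : X₂ → Y₂} {col : Y₁ ⊎ Y₂ → C}
         {σ₁ : Sym Y₁} {σ₂ : Sym Y₂} {τ₁ : Sym X₁} {τ₂ : Sym X₂} where
  IsColouredAut-⊎⁻ : IsColouredAut (Sum.map c₁ c₂) col ((σ₁ ⊎-↔ σ₂) , (τ₁ ⊎-↔ τ₂)) →
                     IsColouredAut c₁ (col ∘ inj₁) (σ₁ , τ₁) × IsColouredAut c₂ (col ∘ inj₂) (σ₂ , τ₂)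
  IsColouredAut-⊎⁻ aut =
    colouredIso (inj₁-injective ∘ intertwines aut ∘ inj₁) (keeps-colour aut ∘ inj₁) ,
    colouredIso (inj₂-injective ∘ intertwines aut ∘ inj₂) (keeps-colour aut ∘ inj₂)

  IsColouredAut-⊎⁺ : IsColouredAut c₁ (col ∘ inj₁) (σ₁ , τ₁) →
                     IsColouredAut c₂ (col ∘ inj₂) (σ₂ , τ₂) →
                     IsColouredAut (Sum.map c₁ c₂) col ((σ₁ ⊎-↔ σ₂) , (τ₁ ⊎-↔ τ₂))
  IsColouredAut-⊎⁺ aut₁ aut₂ = colouredIso
    (λ where (inj₁ x) → cong inj₁ (intertwines aut₁ x)
             (inj₂ x) → cong inj₂ (intertwines aut₂ x))
    (λ where (inj₁ y) → keeps-colour aut₁ y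
             (inj₂ y) → keeps-colour aut₂ y)

-- Permutations of a disjoint union

IsInj₁ : ∀ {A B : Set} → A ⊎ B → Set
IsInj₁ z = ∃ λ a → z ≡ inj₁ a

isInj₁? : ∀ {A B : Set} (z : A ⊎ B) → Dec (IsInj₁ z)
isInj₁? (inj₁ a) = yes (a , refl)
isInj₁? (inj₂ b) = no λ ()

¬isInj₁⇒inj₂ : ∀ {A B : Set} (z : A ⊎ B) → ¬ IsInj₁ z → ∃ λ b → z ≡ inj₂ b
¬isInj₁⇒inj₂ (inj₁ a) ¬inj₁ = contradiction (a , refl) ¬inj₁
¬isInj₁⇒inj₂ (inj₂ b) ¬inj₁ = b , refl

module _ {A B : Set} where
  KeepsLeft : Sym (A ⊎ B) → Set
  KeepsLeft π = ∀ a → IsInj₁ (to π (inj₁ a))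

  KeepsSides : Sym (A ⊎ B) → Set
  KeepsSides π = KeepsLeft π × KeepsLeft (↔-sym π)

  keepsRight : ∀ π → KeepsLeft (↔-sym π) → ∀ b → ∃ λ b′ → to π (inj₂ b) ≡ inj₂ b′
  keepsRight π keeps⁻¹ b with to π (inj₂ b) in eq
  ... | inj₂ b′ = b′ , refl
  ... | inj₁ a with keeps⁻¹ a
  ...   | a′ , eq⁻¹ with () ← trans (sym (trans (sym (cong (from π) eq)) (strictlyInverseʳ π (inj₂ b)))) eq⁻¹

  restrictˡ : ∀ π → KeepsSides π → Sym A
  restrictˡ π (keeps , keeps⁻¹) = mk↔ₛ′ (proj₁ ∘ keeps) (proj₁ ∘ keeps⁻¹)
    (λ a → inj₁-injective (begin
      inj₁ (proj₁ (keeps (proj₁ (keeps⁻¹ a)))) ≡⟨ proj₂ (keeps _) ⟨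
      to π (inj₁ (proj₁ (keeps⁻¹ a)))          ≡⟨ cong (to π) (proj₂ (keeps⁻¹ a)) ⟨
      to π (from π (inj₁ a))                    ≡⟨ strictlyInverseˡ π (inj₁ a) ⟩
      inj₁ a                                    ∎))
    (λ a → inj₁-injective (begin
      inj₁ (proj₁ (keeps⁻¹ (proj₁ (keeps a)))) ≡⟨ proj₂ (keeps⁻¹ _) ⟨
      from π (inj₁ (proj₁ (keeps a)))          ≡⟨ cong (from π) (proj₂ (keeps a)) ⟨
      from π (to π (inj₁ a))                    ≡⟨ strictlyInverseʳ π (inj₁ a) ⟩
      inj₁ a                                    ∎))
    where open ≡-Reasoning

module _ {A B : Set} where
  restrictʳ : ∀ π → KeepsSides π → Sym B
  restrictʳ π (keeps , keeps⁻¹) = restrictˡ (conjugate (⊎-comm A B) π)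
    ( Product.map₂ (cong swap) ∘ keepsRight π keeps⁻¹
    , Product.map₂ (cong swap) ∘ keepsRight (↔-sym π) keeps)

  join : Sym A × Sym B → Sym (A ⊎ B)
  join (σ , τ) = σ ⊎-↔ τ

  restrict : ∀ π → KeepsSides π → Sym A × Sym B
  restrict π k = restrictˡ π k , restrictʳ π k

  join-restrict : ∀ π (k : KeepsSides π) → to π ≗ to (join (restrict π k))
  join-restrict π (keeps , keeps⁻¹) (inj₁ a) = proj₂ (keeps a)
  join-restrict π (keeps , keeps⁻¹) (inj₂ b) = proj₂ (keepsRight π keeps⁻¹ b)

module _ {A B : Set} where
  KeepsSides-isSubgroup : IsSubgroup (Symmetric (A ⊎ B)) KeepsSides
  KeepsSides-isSubgroup = record
    { ε-closed = (λ a → a , refl) , (λ a → a , refl)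
    ; ∙-closed = λ {π} {σ} (π-keeps , π-keeps⁻¹) (σ-keeps , σ-keeps⁻¹) →
        compose {π} {σ} π-keeps σ-keeps , compose {↔-sym σ} {↔-sym π} σ-keeps⁻¹ π-keeps⁻¹
    ; ⁻¹-closed = Product.swap }
    where
    compose : ∀ {π σ} → KeepsLeft π → KeepsLeft σ → KeepsLeft (π ↔-∘ σ)
    compose {π} π-keeps σ-keeps a with σ-keeps a
    ... | a′ , eq = Product.map₂ (trans (cong (to π) eq)) (π-keeps a′)

  join-keepsSides : ∀ (p : Sym A × Sym B) → KeepsSides (join p)
  join-keepsSides (σ , τ) = (λ a → to σ a , refl) , (λ a → from σ a , refl)

  join-cong : ∀ {(σ , τ) (σ′ , τ′) : Sym A × Sym B} → to σ ≗ to σ′ → to τ ≗ to τ′ →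
              to (join (σ , τ)) ≗ to (join (σ′ , τ′))
  join-cong σ≗σ′ τ≗τ′ (inj₁ a) = cong inj₁ (σ≗σ′ a)
  join-cong σ≗σ′ τ≗τ′ (inj₂ b) = cong inj₂ (τ≗τ′ b)

  join-cancel : ∀ ((σ , τ) (σ′ , τ′) : Sym A × Sym B) → to (join (σ , τ)) ≗ to (join (σ′ , τ′)) →
                (to σ ≗ to σ′) × (to τ ≗ to τ′)
  join-cancel _ _ eq = inj₁-injective ∘ eq ∘ inj₁ , inj₂-injective ∘ eq ∘ inj₂

  join-∘ : ∀ ((σ , τ) (σ′ , τ′) : Sym A × Sym B) →
           to (join ((σ ↔-∘ σ′) , (τ ↔-∘ τ′))) ≗ to (join (σ , τ) ↔-∘ join (σ′ , τ′))
  join-∘ _ _ (inj₁ a) = refl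
  join-∘ _ _ (inj₂ b) = refl

  join-id : to (join (↔-id A , ↔-id B)) ≗ id
  join-id (inj₁ a) = refl
  join-id (inj₂ b) = refl

  join-sym : ∀ ((σ , τ) : Sym A × Sym B) → to (join (↔-sym σ , ↔-sym τ)) ≗ from (join (σ , τ))
  join-sym _ (inj₁ a) = refl
  join-sym _ (inj₂ b) = refl

  sidesIso : GroupIso (Subgroup (Symmetric (A ⊎ B)) KeepsSides KeepsSides-isSubgroup) (Symmetric A ⊗ Symmetric B)
  sidesIso = record
    { isEquivalence₁ = On.isEquivalence proj₁ (Symmetric-isEquivalence _)
    ; isEquivalence₂ = ×-isEquivalence (Symmetric-isEquivalence _) (Symmetric-isEquivalence _)
    ; φ = λ (π , k) → restrict π k
    ; φ⁻¹ = λ p → join p , join-keepsSides p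
    ; φ-cong = λ {(π , k)} {(π′ , k′)} π≗π′ → join-cancel (restrict π k) (restrict π′ k′) λ z →
        trans (sym (join-restrict π k z)) (trans (π≗π′ z) (join-restrict π′ k′ z))
    ; φ⁻¹-cong = λ {p} {q} (σ≗σ′ , τ≗τ′) → join-cong {p} {q} σ≗σ′ τ≗τ′
    ; φ∘φ⁻¹ = λ p → let k = join-keepsSides p in
        join-cancel (restrict (join p) k) p (sym ∘ join-restrict (join p) k)
    ; φ⁻¹∘φ = λ (π , k) → sym ∘ join-restrict π k
    ; ∙-homo = λ (π , k) (π′ , k′) → let kk′ = IsSubgroup.∙-closed KeepsSides-isSubgroup {π} {π′} k k′ in
        join-cancel (restrict (π ↔-∘ π′) kk′)
                    (restrictˡ π k ↔-∘ restrictˡ π′ k′ , restrictʳ π k ↔-∘ restrictʳ π′ k′) λ z → begin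
          to (join (restrict (π ↔-∘ π′) kk′)) z                ≡⟨ join-restrict (π ↔-∘ π′) kk′ z ⟨
          to π (to π′ z)                                       ≡⟨ cong (to π) (join-restrict π′ k′ z) ⟩
          to π (to (join (restrict π′ k′)) z)                  ≡⟨ join-restrict π k _ ⟩
          to (join (restrict π k) ↔-∘ join (restrict π′ k′)) z ≡⟨ join-∘ (restrict π k) (restrict π′ k′) z ⟨
          _                                                    ∎
    ; ε-homo = let k = IsSubgroup.ε-closed KeepsSides-isSubgroup in
        join-cancel (restrict (↔-id _) k) (↔-id A , ↔-id B) λ z →
          trans (sym (join-restrict (↔-id _) k z)) (sym (join-id z))
    ; ⁻¹-homo = λ (π , k) → let k⁻¹ = Product.swap k in
        join-cancel (restrict (↔-sym π) k⁻¹) (↔-sym (restrictˡ π k) , ↔-sym (restrictʳ π k)) λ z → begin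
          to (join (restrict (↔-sym π) k⁻¹)) z  ≡⟨ join-restrict (↔-sym π) k⁻¹ z ⟨
          from π z                              ≡⟨ from-≗ π (join (restrict π k)) (join-restrict π k) z ⟩
          from (join (restrict π k)) z          ≡⟨ join-sym (restrict π k) z ⟨
          _                                     ∎ }
    where open ≡-Reasoning

module _ {A B : Set} (Q : A ⊎ B → Set) (Q-left : ∀ a → Q (inj₁ a)) (¬Q-right : ∀ b → ¬ Q (inj₂ b)) where
  preserves⇒keepsLeft : ∀ π → (∀ z → Q z → Q (to π z)) → KeepsLeft π
  preserves⇒keepsLeft π preserves a with to π (inj₁ a) | preserves (inj₁ a) (Q-left a)
  ... | inj₁ a′ | _ = a′ , refl
  ... | inj₂ b | Q-b = contradiction Q-b (¬Q-right b)

  preserves⇒keepsSides : ∀ π → (∀ z → Q z → Q (to π z)) → (∀ z → Q z → Q (from π z)) → KeepsSides π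
  preserves⇒keepsSides π to-preserves from-preserves =
    preserves⇒keepsLeft π to-preserves , preserves⇒keepsLeft (↔-sym π) from-preserves

-- Splitting stabilisers and automorphism groups

IsJust : ∀ {A : Set} → Maybe A → Set
IsJust m = ∃ λ a → m ≡ just a

isJust? : ∀ {A : Set} (m : Maybe A) → Dec (IsJust m)
isJust? (just a) = yes (a , refl)
isJust? nothing  = no λ ()

¬isJust⇒nothing : ∀ {A : Set} (m : Maybe A) → ¬ IsJust m → m ≡ nothing
¬isJust⇒nothing (just a) ¬just with () ← ¬just (a , refl)
¬isJust⇒nothing nothing  _ = refl

withUndefined : ∀ {Z U : Set} → (Z → Maybe Z) → Z ⊎ U → Maybe (Z ⊎ U)
withUndefined e (inj₁ z) = Maybe.map inj₁ (e z)
withUndefined e (inj₂ u) = nothing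

module _ {Z U : Set} {e : Z → Maybe Z} (total : ∀ z → IsJust (e z)) where
  private
    e′ : Z ⊎ U → Maybe (Z ⊎ U)
    e′ = withUndefined e

    stable⇒keepsSides : ∀ {π} → Stable e′ π → KeepsSides π
    stable⇒keepsSides {π} π-stable = preserves⇒keepsSides (IsJust ∘ e′)
      (λ z → inj₁ (proj₁ (total z)) , cong (Maybe.map inj₁) (proj₂ (total z))) (λ _ ())
      π (λ _ (w , eq) → to π w , Stable-just π-stable eq)
      (λ _ (w , eq) → from π w , Stable-just {π = ↔-sym π} (Conjugates-sym π-stable) eq)

    restrict-stable : ∀ {π} (π-stable : Stable e′ π) → Stable e (restrictˡ π (stable⇒keepsSides π-stable))
    restrict-stable {π} π-stable = commuting λ z → map-injective inj₁-injective (begin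
      Maybe.map inj₁ (e (to σ z))           ≡⟨ cong e′ (join-restrict π k (inj₁ z)) ⟨
      e′ (to π (inj₁ z))                    ≡⟨ commutes π-stable (inj₁ z) ⟩
      Maybe.map (to π) (Maybe.map inj₁ (e z)) ≡⟨ map-∘ (e z) ⟨
      Maybe.map (to π ∘ inj₁) (e z)         ≡⟨ map-cong (join-restrict π k ∘ inj₁) (e z) ⟩
      Maybe.map (inj₁ ∘ to σ) (e z)         ≡⟨ map-∘ (e z) ⟩
      Maybe.map inj₁ (Maybe.map (to σ) (e z)) ∎)
      where
      open ≡-Reasoning
      k = stable⇒keepsSides π-stable
      σ = restrictˡ π k

    ⊎-↔-stable : ∀ {σ} (τ : Sym U) → Stable e σ → Stable e′ (σ ⊎-↔ τ)
    ⊎-↔-stable τ σ-stable = commuting λ where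
      (inj₁ z) → trans (cong (Maybe.map inj₁) (commutes σ-stable z))
                       (trans (sym (map-∘ (e z))) (map-∘ (e z)))  -- both sides fuse to map (inj₁ ∘ to σ)
      (inj₂ u) → refl

  Stab-withUndefined : GroupIso (Stab (withUndefined {U = U} e)) (Stab e ⊗ Symmetric U)
  Stab-withUndefined =
    Subgroup-refine sidesIso stable⇒keepsSides restrict-stable (λ {(σ , τ)} → ⊎-↔-stable τ) ⨾
    Subgroup-⊗ˡ (Stable-isSubgroup e) (Symmetric-isEquivalence Z) (Symmetric-isEquivalence U)

retraction : ∀ {X Y : Set} → (X → Y) → Y ⊎ X → Maybe (Y ⊎ X)
retraction c (inj₁ y) = just (inj₁ y)
retraction c (inj₂ x) = just (inj₁ (c x))

module _ {C X Y : Set} (c : X → Y) (col : Y → C)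
         (colour-invariant : ∀ (σ : Sym Y) (τ : Sym X) → (∀ x → c (to τ x) ≡ to σ (c x)) →
                             ∀ y → col (to σ y) ≡ col y) where
  private
    e : Y ⊎ X → Maybe (Y ⊎ X)
    e = retraction c

    stable⇒keepsSides : ∀ {π} → Stable e π → KeepsSides π
    stable⇒keepsSides {π} π-stable = preserves⇒keepsSides {Y} {X} (λ z → e z ≡ just z) (λ _ → refl) (λ _ ())
      π (λ _ → Stable-just π-stable) (λ _ → Stable-just {π = ↔-sym π} (Conjugates-sym π-stable))

    restrict-aut : ∀ {π} (π-stable : Stable e π) → IsColouredAut c col (restrict π (stable⇒keepsSides π-stable))
    restrict-aut {π} π-stable =
      colouredIso intertwines-τ (colour-invariant (restrictˡ π k) (restrictʳ π k) intertwines-τ)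
      where
      k = stable⇒keepsSides π-stable
      intertwines-τ : ∀ x → c (to (restrictʳ π k) x) ≡ to (restrictˡ π k) (c x)
      intertwines-τ x = inj₁-injective (just-injective (begin
        just (inj₁ (c (to (restrictʳ π k) x))) ≡⟨ cong e (join-restrict π k (inj₂ x)) ⟨
        e (to π (inj₂ x))                      ≡⟨ commutes π-stable (inj₂ x) ⟩
        just (to π (inj₁ (c x)))               ≡⟨ cong just (join-restrict π k (inj₁ (c x))) ⟩
        just (inj₁ (to (restrictˡ π k) (c x))) ∎))
        where open ≡-Reasoning

    ⊎-↔-stable : ∀ {σ τ} → IsColouredAut c col (σ , τ) → Stable e (σ ⊎-↔ τ)
    ⊎-↔-stable aut = commuting λ where
      (inj₁ y) → refl
      (inj₂ x) → cong (just ∘ inj₁) (intertwines aut x)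

  Stab-retraction : GroupIso (Stab (retraction c)) (Aut c col)
  Stab-retraction = Subgroup-refine sidesIso stable⇒keepsSides restrict-aut ⊎-↔-stable

module _ {C X₁ X₂ Y₁ Y₂ : Set} (c₁ : X₁ → Y₁) (c₂ : X₂ → Y₂) (col : Y₁ ⊎ Y₂ → C)
         (separated : ∀ y₁ y₂ → col (inj₁ y₁) ≢ col (inj₂ y₂)) where
  private
    c = Sum.map c₁ c₂

    aut⇒keepsSides : ∀ {σ τ} → IsColouredAut c col (σ , τ) → KeepsSides σ × KeepsSides τ
    aut⇒keepsSides {σ} {τ} aut = σ-keeps , τ-keeps
      where
      aut⁻¹ = IsColouredIso-sym aut
      σ-keeps : KeepsSides σ
      σ-keeps = preserves⇒keepsSides (λ y → ∃ λ y₁ → col y ≡ col (inj₁ y₁)) (λ y₁ → y₁ , refl)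
        (λ y₂ (y₁ , eq) → separated y₁ y₂ (sym eq))
        σ (λ y (y₁ , eq) → y₁ , trans (keeps-colour aut y) eq)
        (λ y (y₁ , eq) → y₁ , trans (keeps-colour aut⁻¹ y) eq)
      τ-keeps : KeepsSides τ
      τ-keeps = preserves⇒keepsSides (IsInj₁ ∘ c) (λ x₁ → c₁ x₁ , refl) (λ { _ (_ , ()) }) τ
        (λ x (y₁ , eq) → Product.map₂ (trans (trans (intertwines aut x) (cong (to σ) eq))) (proj₁ σ-keeps y₁))
        (λ x (y₁ , eq) → Product.map₂ (trans (trans (intertwines aut⁻¹ x) (cong (from σ) eq))) (proj₂ σ-keeps y₁))

    restrict-aut : ∀ {(σ , τ) : Sym (Y₁ ⊎ Y₂) × Sym (X₁ ⊎ X₂)} (aut : IsColouredAut c col (σ , τ)) →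
                   let (σ-keeps , τ-keeps) = aut⇒keepsSides aut in
                   IsColouredAut c₁ (col ∘ inj₁) (restrictˡ σ σ-keeps , restrictˡ τ τ-keeps) ×
                   IsColouredAut c₂ (col ∘ inj₂) (restrictʳ σ σ-keeps , restrictʳ τ τ-keeps)
    restrict-aut {σ , τ} aut = let (σ-keeps , τ-keeps) = aut⇒keepsSides aut in
      IsColouredAut-⊎⁻ (IsColouredAut-resp (join-restrict σ σ-keeps) (join-restrict τ τ-keeps) aut)

    restrictBoth : GroupIso (Subgroup (Symmetric (Y₁ ⊎ Y₂) ⊗ Symmetric (X₁ ⊎ X₂)) _
                               (⊗-isSubgroup KeepsSides-isSubgroup KeepsSides-isSubgroup))
                            ((Symmetric Y₁ ⊗ Symmetric X₁) ⊗ (Symmetric Y₂ ⊗ Symmetric X₂))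
    restrictBoth =
      Subgroup-⊗ KeepsSides-isSubgroup KeepsSides-isSubgroup (Symmetric-isEquivalence _) (Symmetric-isEquivalence _) ⨾
      ⊗-congIso sidesIso sidesIso ⨾
      ⊗-interchangeIso (Symmetric-isEquivalence Y₁) (Symmetric-isEquivalence Y₂)
                       (Symmetric-isEquivalence X₁) (Symmetric-isEquivalence X₂)

  Aut-⊎ : GroupIso (Aut c col) (Aut c₁ (col ∘ inj₁) ⊗ Aut c₂ (col ∘ inj₂))
  Aut-⊎ =
    Subgroup-refine restrictBoth aut⇒keepsSides restrict-aut (λ (aut₁ , aut₂) → IsColouredAut-⊎⁺ aut₁ aut₂) ⨾
    Subgroup-⊗ (Aut-isSubgroup c₁ _) (Aut-isSubgroup c₂ _)
      (⊗-isEquivalence {Symmetric Y₁} {Symmetric X₁} (Symmetric-isEquivalence _) (Symmetric-isEquivalence _))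
      (⊗-isEquivalence {Symmetric Y₂} {Symmetric X₂} (Symmetric-isEquivalence _) (Symmetric-isEquivalence _))

module _ {C : Set} {k v : ℕ} (col : Fin k → C) (col-constant : ∀ i j → col i ≡ col j) where
  private
    wreathAction : (Fin k → Sym (Fin v)) → Sym (Fin k) → Sym (Fin k × Fin v)
    wreathAction f σ = mk↔ₛ′
      (λ (i , y) → to σ i , to (f (to σ i)) y)
      (λ (j , y) → from σ j , from (f j) y)
      (λ (j , y) → cancel (strictlyInverseˡ σ j))
      (λ (i , y) → cong₂ _,_ (strictlyInverseʳ σ i) (strictlyInverseʳ (f (to σ i)) y))
      where
      cancel : ∀ {j j′ y} → j′ ≡ j → (j′ , to (f j′) (from (f j) y)) ≡ (j , y)
      cancel {j} {y = y} refl = cong (j ,_) (strictlyInverseˡ (f j) y)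

    fibrePermutation : ∀ {σ τ} → IsColouredAut proj₁ col (σ , τ) → Fin k → Sym (Fin v)
    fibrePermutation {σ} {τ} aut j = mk↔ₛ′
      (λ y → proj₂ (to τ (from σ j , y)))
      (λ y → proj₂ (from τ (j , y)))
      (λ y → cong proj₂ (begin
        to τ (from σ j , proj₂ (from τ (j , y)))  ≡⟨ cong (λ i → to τ (i , proj₂ (from τ (j , y)))) (from-base y) ⟨
        to τ (from τ (j , y))                     ≡⟨ strictlyInverseˡ τ (j , y) ⟩
        (j , y)                                   ∎))
      (λ y → cong proj₂ (begin
        from τ (j , proj₂ (to τ (from σ j , y)))  ≡⟨ cong (λ i → from τ (i , proj₂ (to τ (from σ j , y)))) (to-base y) ⟨
        from τ (to τ (from σ j , y))              ≡⟨ strictlyInverseʳ τ (from σ j , y) ⟩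
        (from σ j , y)                            ∎))
      where
      open ≡-Reasoning
      to-base : ∀ y → proj₁ (to τ (from σ j , y)) ≡ j
      to-base y = trans (intertwines aut _) (strictlyInverseˡ σ j)
      from-base : ∀ y → proj₁ (from τ (j , y)) ≡ from σ j
      from-base y = intertwines (IsColouredIso-sym aut) (j , y)

  Aut-proj₁≅Wreath : GroupIso (Aut proj₁ col) (Wreath k v)
  Aut-proj₁≅Wreath = record
    { isEquivalence₁ = Aut-isEquivalence proj₁ col
    ; isEquivalence₂ = Wreath-isEquivalence k v
    ; φ = λ ((σ , τ) , aut) → fibrePermutation aut , σ
    ; φ⁻¹ = λ (f , σ) → (σ , wreathAction f σ) , colouredIso (λ _ → refl) (λ _ → col-constant _ _)
    ; φ-cong = λ {((σ , τ) , _)} {((σ′ , τ′) , _)} (σ≗σ′ , τ≗τ′) →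
        (λ j y → cong proj₂ (trans (cong (λ i → to τ (i , y)) (from-≗ σ σ′ σ≗σ′ j)) (τ≗τ′ _))) , σ≗σ′
    ; φ⁻¹-cong = λ {(f , σ)} {(f′ , σ′)} (f≈f′ , σ≗σ′) → σ≗σ′ , λ (i , y) →
        cong₂ _,_ (σ≗σ′ i) (trans (cong (λ j → to (f j) y) (σ≗σ′ i)) (f≈f′ _ y))
    ; φ∘φ⁻¹ = λ (f , σ) → (λ j y → cong (λ j′ → to (f j′) y) (strictlyInverseˡ σ j)) , (λ _ → refl)
    ; φ⁻¹∘φ = λ ((σ , τ) , aut) → (λ _ → refl) , λ (i , y) →
        cong₂ _,_ (sym (intertwines aut (i , y))) (cong (λ i′ → proj₂ (to τ (i′ , y))) (strictlyInverseʳ σ i))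
    ; ∙-homo = λ ((σ , τ) , _) ((σ′ , τ′) , aut′) →
        (λ j y → cong (λ i → proj₂ (to τ (i , proj₂ (to τ′ (from σ′ (from σ j) , y)))))
                      (trans (intertwines aut′ _) (strictlyInverseˡ σ′ (from σ j)))) ,
        (λ _ → refl)
    ; ε-homo = (λ j y → refl) , (λ _ → refl)
    ; ⁻¹-homo = λ _ → (λ j y → refl) , (λ _ → refl) }

Aut-empty⊗ : ∀ {C} (c : Fin 0 → Fin 0) (col : Fin 0 → C) {G} → ≈-IsEquivalence G → GroupIso (Aut c col ⊗ G) G
Aut-empty⊗ {C} c col {G} ≈G = record
  { isEquivalence₁ = ⊗-isEquivalence {Aut c col} {G} (Aut-isEquivalence c col) ≈G
  ; isEquivalence₂ = ≈G
  ; φ = proj₂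
  ; φ⁻¹ = λ g → RawGroup.ε (Aut {C} c col) , g
  ; φ-cong = proj₂
  ; φ⁻¹-cong = λ g≈g′ → ((λ ()) , (λ ())) , g≈g′
  ; φ∘φ⁻¹ = λ _ → G.refl
  ; φ⁻¹∘φ = λ _ → ((λ ()) , (λ ())) , G.refl
  ; ∙-homo = λ _ _ → G.refl
  ; ε-homo = G.refl
  ; ⁻¹-homo = λ _ → G.refl }
  where module G = IsEquivalence ≈G

-- Counting fibres

record Partition {n} (P : Pred (Fin n) 0ℓ) : Set where
  field
    #yes #no : ℕ
    size     : #yes + #no ≡ n
    split    : Fin n ↔ (Fin #yes ⊎ Fin #no)
    yes-sat  : ∀ a → P (from split (inj₁ a))
    no-unsat : ∀ b → ¬ P (from split (inj₂ b))

prependYes : ∀ {n k l} → Fin n ↔ (Fin k ⊎ Fin l) → Fin (suc n) ↔ (Fin (suc k) ⊎ Fin l)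
prependYes {k = k} {l} h =
  (↔-sym +↔⊎ ⊎-↔ ↔-id _) ↔-∘
  (↔-sym (⊎-assoc 0ℓ (Fin 1) (Fin k) (Fin l)) ↔-∘
  ((↔-id _ ⊎-↔ h) ↔-∘
  +↔⊎ {1}))

prependNo : ∀ {n k l} → Fin n ↔ (Fin k ⊎ Fin l) → Fin (suc n) ↔ (Fin k ⊎ Fin (suc l))
prependNo h = ⊎-comm _ _ ↔-∘ prependYes (⊎-comm _ _ ↔-∘ h)

partition : ∀ {n} {P : Pred (Fin n) 0ℓ} → Decidable P → Partition P
partition {zero} P? = record
  { #yes = 0 ; #no = 0 ; size = refl ; split = +↔⊎ ; yes-sat = λ () ; no-unsat = λ () }
partition {suc n} {P} P? with partition (P? ∘ suc) | P? zero
... | Π | yes P0 = record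
  { #yes = suc #yes
  ; #no = #no
  ; size = cong suc size
  ; split = prependYes split
  ; yes-sat = λ where zero → P0
                      (suc a) → yes-sat a
  ; no-unsat = no-unsat }
  where open Partition Π
... | Π | no ¬P0 = record
  { #yes = #yes
  ; #no = suc #no
  ; size = trans (+-suc #yes #no) (cong suc size)
  ; split = prependNo split
  ; yes-sat = yes-sat
  ; no-unsat = λ where zero → ¬P0
                       (suc b) → no-unsat b }
  where open Partition Π

module _ {n} {P : Pred (Fin n) 0ℓ} (Π : Partition P) where
  open Partition Π

  Partition-yes : ∀ {x} → P x → ∃ λ a → from split (inj₁ a) ≡ x
  Partition-yes {x} Px with to split x in eq
  ... | inj₁ a = a , trans (cong (from split) (sym eq)) (strictlyInverseʳ split x)
  ... | inj₂ b = contradiction (subst P (sym (trans (cong (from split) (sym eq)) (strictlyInverseʳ split x))) Px)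
                              (no-unsat b)

sum-const : ∀ n {c} (f : Fin n → ℕ) → (∀ i → f i ≡ c) → sum f ≡ n * c
sum-const zero f f≡c = refl
sum-const (suc n) f f≡c = cong₂ _+_ (f≡c zero) (sum-const n (f ∘ suc) (f≡c ∘ suc))

sum-splitAt : ∀ a {b} (g : Fin a ⊎ Fin b → ℕ) → sum (g ∘ to +↔⊎) ≡ sum (g ∘ inj₁) + sum (g ∘ inj₂)
sum-splitAt zero g = refl
sum-splitAt (suc a) g =
  trans (cong (g (inj₁ zero) +_) (sum-splitAt a (g ∘ Sum.map₁ suc))) (sym (+-assoc (g (inj₁ zero)) _ _))

sum-↔⊎ : ∀ {t a b} (h : Fin t ↔ (Fin a ⊎ Fin b)) (f : Fin t → ℕ) →
         sum f ≡ sum (f ∘ from h ∘ inj₁) + sum (f ∘ from h ∘ inj₂)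
sum-↔⊎ {a = a} h f = trans (sum-permute f (↔-sym h ↔-∘ +↔⊎)) (sum-splitAt a (f ∘ from h))

indicator : ∀ {P : Set} → Dec P → ℕ
indicator (yes _) = 1
indicator (no _)  = 0

indicator-yes : ∀ {P : Set} → P → (P? : Dec P) → indicator P? ≡ 1
indicator-yes p (yes _) = refl
indicator-yes p (no ¬p) = contradiction p ¬p

indicator-no : ∀ {P : Set} → ¬ P → (P? : Dec P) → indicator P? ≡ 0
indicator-no ¬p (yes p) = contradiction p ¬p
indicator-no ¬p (no _)  = refl

indicator-cong : ∀ {P Q : Set} → (P → Q) → (Q → P) → (P? : Dec P) (Q? : Dec Q) → indicator P? ≡ indicator Q?
indicator-cong P⇒Q Q⇒P (yes p) Q? = sym (indicator-yes (P⇒Q p) Q?)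
indicator-cong P⇒Q Q⇒P (no ¬p) Q? = sym (indicator-no (¬p ∘ Q⇒P) Q?)

fibreSize : ∀ {t r} → (Fin t → Fin r) → Fin r → ℕ
fibreSize c j = sum (λ x → indicator (c x ≟ j))

fibreSize-invariant : ∀ {t r} (c : Fin t → Fin r) (σ : Fin r ↔ Fin r) (τ : Fin t ↔ Fin t) →
                      (∀ x → c (to τ x) ≡ to σ (c x)) → ∀ j → fibreSize c (to σ j) ≡ fibreSize c j
fibreSize-invariant c σ τ intertwines j = trans (sum-permute (λ x → indicator (c x ≟ to σ j)) τ)
  (sum-cong-≗ λ x → indicator-cong
    (λ cτx≡σj → trans (sym (strictlyInverseʳ σ (c x)))
                      (trans (cong (from σ) (trans (sym (intertwines x)) cτx≡σj)) (strictlyInverseʳ σ j)))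
    (λ cx≡j → trans (intertwines x) (cong (to σ) cx≡j))
    _ _)

record Restriction {t r k l} (c : Fin t → Fin r) (hY : Fin r ↔ (Fin k ⊎ Fin l)) : Set where
  field
    t₁ t₂  : ℕ
    size   : t₁ + t₂ ≡ t
    hX     : Fin t ↔ (Fin t₁ ⊎ Fin t₂)
    c₁     : Fin t₁ → Fin k
    c₂     : Fin t₂ → Fin l
    square : ∀ z → c (from hX z) ≡ from hY (Sum.map c₁ c₂ z)

restrictAlong : ∀ {t r k l} (c : Fin t → Fin r) (hY : Fin r ↔ (Fin k ⊎ Fin l)) → Restriction c hY
restrictAlong c hY = record
  { t₁ = #yes ; t₂ = #no ; size = size ; hX = split
  ; c₁ = proj₁ ∘ yes-sat
  ; c₂ = λ i → proj₁ (right i)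
  ; square = λ where
      (inj₁ i) → onto (proj₂ (yes-sat i))
      (inj₂ i) → onto (proj₂ (right i)) }
  where
  open Partition (partition (isInj₁? ∘ to hY ∘ c))
  right : ∀ i → ∃ λ b → to hY (c (from split (inj₂ i))) ≡ inj₂ b
  right i = ¬isInj₁⇒inj₂ _ (no-unsat i)
  onto : ∀ {x w} → to hY (c x) ≡ w → c x ≡ from hY w
  onto {x} eq = trans (sym (strictlyInverseʳ hY (c x))) (cong (from hY) eq)

module _ {t r k l} {c : Fin t → Fin r} {hY : Fin r ↔ (Fin k ⊎ Fin l)} (R : Restriction c hY) where
  open Restriction R

  fibreSize-restrictˡ : ∀ j → fibreSize c₁ j ≡ fibreSize c (from hY (inj₁ j))
  fibreSize-restrictˡ j = sym (begin
    fibreSize c (from hY (inj₁ j))  ≡⟨ sum-↔⊎ hX _ ⟩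
    _                               ≡⟨ cong₂ _+_ (sum-cong-≗ inside)
                                                 (sum-const t₂ (λ i → indicator (c (from hX (inj₂ i)) ≟ from hY (inj₁ j))) outside) ⟩
    fibreSize c₁ j + t₂ * 0         ≡⟨ cong (fibreSize c₁ j +_) (*-zeroʳ t₂) ⟩
    fibreSize c₁ j + 0              ≡⟨ +-identityʳ _ ⟩
    fibreSize c₁ j                  ∎)
    where
    open ≡-Reasoning
    inside : ∀ i → indicator (c (from hX (inj₁ i)) ≟ from hY (inj₁ j)) ≡ indicator (c₁ i ≟ j)
    inside i = indicator-cong
      (λ eq → inj₁-injective (from-injective hY (trans (sym (square (inj₁ i))) eq)))
      (λ eq → trans (square (inj₁ i)) (cong (from hY ∘ inj₁) eq)) _ _
    outside : ∀ i → indicator (c (from hX (inj₂ i)) ≟ from hY (inj₁ j)) ≡ 0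
    outside i = indicator-no (λ eq → case from-injective hY (trans (sym (square (inj₂ i))) eq) of λ ()) _

  fibreSize-restrictʳ : ∀ j → fibreSize c₂ j ≡ fibreSize c (from hY (inj₂ j))
  fibreSize-restrictʳ j = sym (begin
    fibreSize c (from hY (inj₂ j))  ≡⟨ sum-↔⊎ hX _ ⟩
    _                               ≡⟨ cong₂ _+_ (sum-const t₁ (λ i → indicator (c (from hX (inj₁ i)) ≟ from hY (inj₂ j))) outside)
                                                 (sum-cong-≗ inside) ⟩
    t₁ * 0 + fibreSize c₂ j         ≡⟨ cong (_+ fibreSize c₂ j) (*-zeroʳ t₁) ⟩
    fibreSize c₂ j                  ∎)
    where
    open ≡-Reasoning
    inside : ∀ i → indicator (c (from hX (inj₂ i)) ≟ from hY (inj₂ j)) ≡ indicator (c₂ i ≟ j)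
    inside i = indicator-cong
      (λ eq → inj₂-injective (from-injective hY (trans (sym (square (inj₂ i))) eq)))
      (λ eq → trans (square (inj₂ i)) (cong (from hY ∘ inj₂) eq)) _ _
    outside : ∀ i → indicator (c (from hX (inj₁ i)) ≟ from hY (inj₂ j)) ≡ 0
    outside i = indicator-no (λ eq → case from-injective hY (trans (sym (square (inj₁ i))) eq) of λ ()) _

⊎×↔suc× : ∀ {k v} → (Fin v ⊎ (Fin k × Fin v)) ↔ (Fin (suc k) × Fin v)
⊎×↔suc× = mk↔ₛ′
  (λ where (inj₁ y) → zero , y
           (inj₂ (j , y)) → suc j , y)
  (λ where (zero , y) → inj₁ y
           (suc j , y) → inj₂ (j , y))
  (λ where (zero , y) → refl
           (suc j , y) → refl)
  (λ where (inj₁ y) → refl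
           (inj₂ (j , y)) → refl)

record Trivialisation {t k} (c : Fin t → Fin k) (v : ℕ) : Set where
  field
    size           : t ≡ k * v
    trivialisation : Fin t ↔ (Fin k × Fin v)
    proj₁-trivialisation : ∀ x → proj₁ (to trivialisation x) ≡ c x

trivialise : ∀ k {t} (c : Fin t → Fin k) v → (∀ j → fibreSize c j ≡ v) → Trivialisation c v
trivialise zero {zero} c v _ = record
  { size = refl ; trivialisation = mk↔ₛ′ (λ ()) (λ ()) (λ ()) (λ ()) ; proj₁-trivialisation = λ () }
trivialise zero {suc t} c v _ with () ← c zero
trivialise (suc k) {t} c v uniform = record
  { size = trans (sym size) (cong₂ _+_ t₁≡v (Trivialisation.size rest))
  ; trivialisation = h ↔-∘ hX
  ; proj₁-trivialisation = λ x →
      trans (proj₁-h (to hX x)) (trans (sym (square (to hX x))) (cong c (strictlyInverseʳ hX x))) }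
  where
  R = restrictAlong c (+↔⊎ {1} {k})
  open Restriction R
  t₁≡v : t₁ ≡ v
  t₁≡v = begin
    t₁                       ≡⟨ *-identityʳ t₁ ⟨
    t₁ * 1                   ≡⟨ sum-const t₁ _ (λ i → indicator-yes (Fin1-is-zero (c₁ i)) (c₁ i ≟ zero)) ⟨
    fibreSize c₁ zero        ≡⟨ fibreSize-restrictˡ R zero ⟩
    fibreSize c zero         ≡⟨ uniform zero ⟩
    v                        ∎
    where
    open ≡-Reasoning
    Fin1-is-zero : (i : Fin 1) → i ≡ zero
    Fin1-is-zero zero = refl
  rest : Trivialisation c₂ v
  rest = trivialise k c₂ v (λ j → trans (fibreSize-restrictʳ R j) (uniform (suc j)))
  h : (Fin t₁ ⊎ Fin t₂) ↔ (Fin (suc k) × Fin v)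
  h = ⊎×↔suc× ↔-∘ (subst (λ m → Fin t₁ ↔ Fin m) t₁≡v (↔-id _) ⊎-↔ Trivialisation.trivialisation rest)
  proj₁-h : ∀ z → proj₁ (to h z) ≡ from (+↔⊎ {1}) (Sum.map c₁ c₂ z)
  proj₁-h (inj₁ i) with c₁ i
  ... | zero = refl
  proj₁-h (inj₂ i) = cong suc (Trivialisation.proj₁-trivialisation rest i)

-- Decomposition by fibre size

module ColourClass {r t} (c : Fin t → Fin (suc r)) (col : Fin (suc r) → ℕ)
                   (fibres : ∀ j → fibreSize c j ≡ col j) where
  v : ℕ
  v = col zero

  private
    Π = partition (λ j → col j ℕ.≟ v)
  open Partition Π public using () renaming (#yes to k; #no to l; size to k+l≡suc-r; split to hY)
  open Partition Π using (yes-sat; no-unsat)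

  R : Restriction c hY
  R = restrictAlong c hY
  open Restriction R public

  col₁ : Fin k → ℕ
  col₁ = col ∘ from hY ∘ inj₁

  col₂ : Fin l → ℕ
  col₂ = col ∘ from hY ∘ inj₂

  col₂≢v : ∀ j → col₂ j ≢ v
  col₂≢v = no-unsat

  fibres₂ : ∀ j → fibreSize c₂ j ≡ col₂ j
  fibres₂ j = trans (fibreSize-restrictʳ R j) (fibres _)

  k-positive : 1 ≤ k
  k-positive = ≤-trans (s≤s z≤n) (toℕ<n (proj₁ (Partition-yes Π {zero} refl)))

  l<suc-r : l < suc r
  l<suc-r = subst (l <_) k+l≡suc-r (+-monoˡ-≤ l k-positive)

  T : Trivialisation c₁ v
  T = trivialise k c₁ v (λ j → trans (fibreSize-restrictˡ R j) (trans (fibres _) (yes-sat j)))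

  sorted : IsColouredIso hY hX c col (Sum.map c₁ c₂) (col ∘ from hY)
  sorted = colouredIso
    (λ x → sym (begin
      to hY (c x)                               ≡⟨ cong (to hY ∘ c) (strictlyInverseʳ hX x) ⟨
      to hY (c (from hX (to hX x)))             ≡⟨ cong (to hY) (square (to hX x)) ⟩
      to hY (from hY (Sum.map c₁ c₂ (to hX x))) ≡⟨ strictlyInverseˡ hY _ ⟩
      Sum.map c₁ c₂ (to hX x)                   ∎))
    (λ y → cong col (strictlyInverseʳ hY y))
    where open ≡-Reasoning

  separated : ∀ y₁ y₂ → col₁ y₁ ≢ col₂ y₂
  separated y₁ y₂ eq = col₂≢v y₂ (trans (sym eq) (yes-sat y₁))

  Aut₁≅Wreath : GroupIso (Aut c₁ col₁) (Wreath k v)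
  Aut₁≅Wreath =
    Aut-transport (colouredIso {hY = ↔-id _} {Trivialisation.trivialisation T}
                               (Trivialisation.proj₁-trivialisation T) (λ _ → refl)) ⨾
    Aut-proj₁≅Wreath col₁ (λ i j → trans (yes-sat i) (sym (yes-sat j)))

  Aut≅Wreath⊗Aut : GroupIso (Aut c col) (Wreath k v ⊗ Aut c₂ col₂)
  Aut≅Wreath⊗Aut =
    Aut-transport sorted ⨾
    Aut-⊎ c₁ c₂ (col ∘ from hY) separated ⨾
    ⊗-congIso Aut₁≅Wreath (GroupIso-refl (Aut-isEquivalence c₂ col₂))

record WreathDecomposition {r t} (c : Fin t → Fin r) (col : Fin r → ℕ) (m : ℕ) : Set where
  field
    factors  : List (ℕ × ℕ)
    positive : All (λ p → 1 ≤ proj₁ p × 1 ≤ proj₂ p) factors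
    distinct : Unique (map proj₁ factors)
    colours  : All (λ p → ∃ λ j → proj₁ p ≡ suc (col j)) factors
    weight≡  : weight factors ≡ r + t
    iso      : GroupIso (Aut c col ⊗ SymGroup m) (WreathProduct factors m)

decompose : ∀ {r} → Acc _<_ r → ∀ {t} (c : Fin t → Fin r) (col : Fin r → ℕ) →
            (∀ j → fibreSize c j ≡ col j) → ∀ m → WreathDecomposition c col m
decompose {zero} _ {zero} c col _ m = record
  { factors = [] ; positive = [] ; distinct = AllPairs.[] ; colours = [] ; weight≡ = refl
  ; iso = Aut-empty⊗ c col (Symmetric-isEquivalence (Fin m)) }
decompose {zero} _ {suc t} c col _ m with () ← c zero
decompose {suc r} (acc rs) {t} c col fibres m = record
  { factors = (suc v , k) ∷ D.factors
  ; positive = (s≤s z≤n , k-positive) ∷ D.positive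
  ; distinct = All.map⁺ (All.map (λ (j , eq) sv≡ → col₂≢v j (suc-injective (trans (sym eq) (sym sv≡))))
                                 D.colours)
               AllPairs.∷ D.distinct
  ; colours = (zero , refl) ∷ All.map (λ (j , eq) → from hY (inj₂ j) , eq) D.colours
  ; weight≡ = begin
      k * suc v + weight D.factors ≡⟨ cong₂ _+_ (*-suc k v) D.weight≡ ⟩
      (k + k * v) + (l + t₂)       ≡⟨ interchange k (k * v) l t₂ ⟩
      (k + l) + (k * v + t₂)       ≡⟨ cong₂ _+_ k+l≡suc-r (cong (_+ t₂) (sym (Trivialisation.size T))) ⟩
      suc r + (t₁ + t₂)            ≡⟨ cong (suc r +_) size ⟩
      suc r + t                    ∎
  ; iso = ⊗-congIso Aut≅Wreath⊗Aut (GroupIso-refl ≈Sym) ⨾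
          ⊗-assocIso (Wreath-isEquivalence k v) (Aut-isEquivalence c₂ col₂) ≈Sym ⨾
          ⊗-congIso (GroupIso-refl (Wreath-isEquivalence k v)) D.iso }
  where
  open ColourClass c col fibres
  open ≡-Reasoning
  module D = WreathDecomposition (decompose (rs l<suc-r) c₂ col₂ fibres₂ m)
  ≈Sym = Symmetric-isEquivalence (Fin m)

-- Normal form of an idempotent

idempotent-image-fixed : ∀ {n} {e : PT n} → IsIdempotent e → ∀ {i w} → e i ≡ just w → e w ≡ just w
idempotent-image-fixed {e = e} idem {i} ei≡w = trans (sym (cong (_>>= e) ei≡w)) (trans (idem i) ei≡w)

retraction-total : ∀ {X Y : Set} (c : X → Y) (z : Y ⊎ X) → IsJust (retraction c z)
retraction-total c (inj₁ y) = inj₁ y , refl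
retraction-total c (inj₂ x) = inj₁ (c x) , refl

module NormalForm {n} (e : PT n) (idem : IsIdempotent e) where
  private
    Π₁ = partition (isJust? ∘ e)
    open Partition Π₁ using () renaming (#yes to d; split to split₁)

    Fixed : Fin d → Set
    Fixed y = e (from split₁ (inj₁ y)) ≡ just (from split₁ (inj₁ y))

    Π₂ : Partition Fixed
    Π₂ = partition (λ y → ≡-dec _≟_ (e (from split₁ (inj₁ y))) (just (from split₁ (inj₁ y))))

  open Partition Π₁ public using () renaming (#no to m)
  open Partition Π₂ public using () renaming (#yes to r; #no to t)

  size : (r + t) + m ≡ n
  size = trans (cong (_+ m) (Partition.size Π₂)) (Partition.size Π₁)

  -- h sorts [n] into fixed points, the other points in the domain, and points outside it.
  h : Fin n ↔ ((Fin r ⊎ Fin t) ⊎ Fin m)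
  h = (Partition.split Π₂ ⊎-↔ ↔-id _) ↔-∘ split₁

  private
    undefined : ∀ u → e (from h (inj₂ u)) ≡ nothing
    undefined u = ¬isJust⇒nothing _ (Partition.no-unsat Π₁ u)

    fixed : ∀ j → e (from h (inj₁ (inj₁ j))) ≡ just (from h (inj₁ (inj₁ j)))
    fixed = Partition.yes-sat Π₂

    moved : ∀ x → IsJust (e (from h (inj₁ (inj₂ x))))
    moved x = Partition.yes-sat Π₁ _

    fixed⇒index : ∀ {w} → e w ≡ just w → ∃ λ j → from h (inj₁ (inj₁ j)) ≡ w
    fixed⇒index {w} ew≡w with Partition-yes Π₁ (w , ew≡w)
    ... | y , y↦w with Partition-yes Π₂ {y} (subst (λ z → e z ≡ just z) (sym y↦w) ew≡w)
    ...   | j , j↦y = j , trans (cong (from split₁ ∘ inj₁) j↦y) y↦w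

    moved↦fixed : ∀ x → ∃ λ j → e (from h (inj₁ (inj₂ x))) ≡ just (from h (inj₁ (inj₁ j)))
    moved↦fixed x with moved x
    ... | w , ez≡w with fixed⇒index (idempotent-image-fixed idem ez≡w)
    ...   | j , j↦w = j , trans ez≡w (cong just (sym j↦w))

  c : Fin t → Fin r
  c x = proj₁ (moved↦fixed x)

  conjugates : Conjugates h e (withUndefined (retraction c))
  conjugates = commuting λ i → trans (normal (to h i)) (cong (Maybe.map (to h) ∘ e) (strictlyInverseʳ h i))
    where
    normal : ∀ z → withUndefined (retraction c) z ≡ Maybe.map (to h) (e (from h z))
    normal (inj₁ (inj₁ j)) =
      sym (trans (cong (Maybe.map (to h)) (fixed j)) (cong just (strictlyInverseˡ h _)))
    normal (inj₁ (inj₂ x)) =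
      sym (trans (cong (Maybe.map (to h)) (proj₂ (moved↦fixed x))) (cong just (strictlyInverseˡ h _)))
    normal (inj₂ u) = sym (cong (Maybe.map (to h)) (undefined u))

corollary6p6 : ∀ (n : ℕ) (e : PT n) → IsIdempotent e →
    ∃ λ (ps : List (ℕ × ℕ)) → ∃ λ (m : ℕ) →
      All (λ p → 1 ≤ proj₁ p × 1 ≤ proj₂ p) ps
      × Unique (map proj₁ ps)
      × m + weight ps ≡ n
      × StabGroup e ≅ WreathProduct ps m
corollary6p6 n e idem =
  D.factors , m , D.positive , D.distinct , trans (+-comm m _) (trans (cong (_+ m) D.weight≡) size) ,
  GroupIso⇒≅ (StabGroup≅Stab e ⨾
               Stab-transport conjugates ⨾
               Stab-withUndefined (retraction-total c) ⨾
               ⊗-congIso (Stab-retraction c (fibreSize c) (fibreSize-invariant c))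
                         (GroupIso-refl (Symmetric-isEquivalence (Fin m))) ⨾
               D.iso)
  where
  open NormalForm e idem
  module D = WreathDecomposition (decompose (<-wellFounded r) c (fibreSize c) (λ _ → refl) m)
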